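{- Let $t\geq 1$, $\ell\geq 3$, $k\geq t+\ell-2$ be integers and let $\mathcal{F}\subset\binom{[n]}{k}$ be a family such that $\binom{\ell}{2}(t-1)+\binom{\ell-1}{2}\leq \sum_{1\leq i<j\leq \ell}|F_i\cap F_j|$ for every choice of $\ell$ distinct members $F_1,\dots,F_\ell$ of $\mathcal{F}$. Suppose $\mathcal{F}$ contains a sunflower with a kernel $T$ of size $t$ and $2k+\ell-2$ petals. For $a\in T$ let $\mathcal{F}(T-\{a\},\bar a)=\{F\in\mathcal{F}: T\setminus\{a\}\subseteq F,\ a\notin F\}$. Then $\mathcal{F}(T-\{a\},\bar a)$ is $(t-1+\ell-2)$-intersecting, i.e. any two distinct members $F,G$ of it satisfy $|F\cap G|\geq t+\ell-3$ (equivalently $|(F\setminus T)\cap(G\setminus T)|\geq \ell-2$).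
   Context: $\binom{[n]}{k}$ denotes the family of all $k$-element subsets of $[n]=\{1,\dots,n\}$. A sunflower with kernel $T$ ($|T|=t$) and $u$ petals is a family of $u$ sets $T\cup P_1,\dots,T\cup P_u$ of size $k$, where $P_1,\dots,P_u$ (the petals) are pairwise disjoint and disjoint from $T$. -}

module Defs where

open import Data.Nat using (ℕ; zero; suc; _+_; _*_; _∸_; _≤_)
open import Data.Nat.Combinatorics using (_C_)
open import Data.Fin using (Fin; zero; suc)
open import Data.Fin.Subset using (Subset; _∩_; _∪_; _-_; _∈_; _∉_; _⊆_; ∣_∣; ⊥)
open import Data.List using (map; allFin)
open import Data.Nat.ListAction using (sum)
open import Data.Product using (Σ; _×_)
open import Function.Definitions using (Injective)
open import Relation.Binary.PropositionalEquality using (_≡_)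
open import Relation.Nullary using (¬_)

Family : ℕ → Set₁
Family n = Subset n → Set

Uniform : ∀ {n} → ℕ → Family n → Set
Uniform k 𝓕 = ∀ F → 𝓕 F → ∣ F ∣ ≡ k

-- Σ_{1 ≤ i < j ≤ ℓ} |F_i ∩ F_j|
pairSum : ∀ {n} (ℓ : ℕ) → (Fin ℓ → Subset n) → ℕ
pairSum zero    Fs = 0
pairSum (suc ℓ) Fs =
  sum (map (λ j → ∣ Fs zero ∩ Fs (suc j) ∣) (allFin ℓ)) + pairSum ℓ (λ i → Fs (suc i))

PairCondition : ∀ {n} (t ℓ : ℕ) → Family n → Set
PairCondition t ℓ 𝓕 =
  (Fs : Fin ℓ → Subset _) → Injective _≡_ _≡_ Fs → (∀ i → 𝓕 (Fs i)) →
  (ℓ C 2) * (t ∸ 1) + ((ℓ ∸ 1) C 2) ≤ pairSum ℓ Fs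

HasSunflower : ∀ {n} → Family n → Subset n → ℕ → Set
HasSunflower {n} 𝓕 T u =
  Σ (Fin u → Subset n) λ P →
    (∀ i → P i ∩ T ≡ ⊥) ×
    (∀ i j → ¬ i ≡ j → P i ∩ P j ≡ ⊥) ×
    (∀ i → 𝓕 (T ∪ P i))

Link : ∀ {n} → Family n → Subset n → Fin n → Family n
Link 𝓕 T a F = 𝓕 F × (T - a) ⊆ F × a ∉ F

Intersecting : ∀ {n} → ℕ → Family n → Set
Intersecting s 𝓕 = ∀ F G → 𝓕 F → 𝓕 G → ¬ F ≡ G → s ≤ ∣ F ∩ G ∣

-- Take F ≠ G in the link and let s = t − 1, m = ℓ − 2. Each petal meeting F ∪ G uses up a
-- point of F ∪ G, so at least (2k + m) − 2k = m petals avoid both F and G. With the sets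
-- S_i = T ∪ P_i of those petals, F, G, S_1, …, S_m are ℓ distinct members of 𝓕. Since a ∉ F, G
-- and the petals avoid F and G, |F ∩ S_i|, |G ∩ S_i| ≤ |T − a| = s, while |S_i ∩ S_j| ≤ |T| = s + 1.
-- The pair condition then reads C(m+2,2) s + C(m+1,2) ≤ |F ∩ G| + 2ms + C(m,2)(s+1), and since
-- the left side is 2ms + C(m,2)(s+1) + s + m, this is |F ∩ G| ≥ s + m.
module Submission where

open import Defs
open import Data.Nat using (ℕ; _+_; _*_; _∸_; _≤_)
open import Data.Fin using (Fin)
open import Data.Fin.Subset using (Subset; _∈_; ∣_∣)
open import Relation.Binary.PropositionalEquality using (_≡_)

open import Data.Nat using (zero; suc; z≤n; s≤s; _<_)
open import Data.Nat.Properties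
  using ( +-assoc; +-comm; +-suc; +-identityʳ; *-distribʳ-+; +-∸-assoc; ≤-reflexive; ≤-trans
        ; ≤-<-trans; ≤-pred; <⇒≱; m<m+n; m+n≤o⇒n≤o; +-mono-≤; +-monoˡ-≤; +-monoʳ-≤; +-cancelˡ-≤
        ; module ≤-Reasoning )
open import Data.Nat.Combinatorics using (_C_; nC1≡n; nCk+nC[k+1]≡[n+1]C[k+1])
open import Data.Nat.Tactic.RingSolver using (solve-∀)
open import Data.Fin using (zero; suc)
open import Data.Fin.Properties using (suc-injective) renaming (_≟_ to _≟ᶠ_)
open import Data.Fin.Subset using (_∩_; _∪_; _-_; _∉_; _⊆_; inside; outside) renaming (⊥ to ∅)
open import Data.Fin.Subset.Properties
  using (∣p∣≤∣x∷p∣; x∈p∩q⁺; x∈p∩q⁻; x∈p∪q⁺; x∈p∪q⁻; ∉⊥; nonempty?; p⊆q⇒∣p∣≤∣q∣; x∈p⇒∣p-x∣<∣p∣; x∈p∧x≢y⇒x∈p-y)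
open import Data.Vec using ([]; _∷_)
open import Data.Vec.Functional using (Vector) renaming (_∷_ to _◂_)
open import Data.List using (map; tabulate)
open import Data.Nat.ListAction using (sum)
open import Data.Product using (Σ; _×_; _,_; proj₁; proj₂)
open import Data.Sum using (inj₁; inj₂)
open import Data.Empty using (⊥; ⊥-elim)
open import Function using (_∘_)
open import Function.Definitions using (Injective)
open import Relation.Binary.PropositionalEquality using (_≢_; refl; sym; trans; cong; cong₂; subst; subst₂; module ≡-Reasoning)
open import Relation.Nullary using (yes; no)

Disjoint : ∀ {n} → Subset n → Subset n → Set
Disjoint A B = ∀ {x} → x ∈ A → x ∈ B → ⊥

PairwiseDisjoint : ∀ {n u} → (Fin u → Subset n) → Set
PairwiseDisjoint P = ∀ i j → i ≢ j → Disjoint (P i) (P j)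

∩≡∅⇒Disjoint : ∀ {n} {A B : Subset n} → A ∩ B ≡ ∅ → Disjoint A B
∩≡∅⇒Disjoint A∩B≡∅ x∈A x∈B = ∉⊥ (subst (_ ∈_) A∩B≡∅ (x∈p∩q⁺ (x∈A , x∈B)))

∣p∪q∣≤∣p∣+∣q∣ : ∀ {n} (p q : Subset n) → ∣ p ∪ q ∣ ≤ ∣ p ∣ + ∣ q ∣
∣p∪q∣≤∣p∣+∣q∣ []            []            = z≤n
∣p∪q∣≤∣p∣+∣q∣ (outside ∷ p) (outside ∷ q) = ∣p∪q∣≤∣p∣+∣q∣ p q
∣p∪q∣≤∣p∣+∣q∣ (outside ∷ p) (inside  ∷ q) =
  subst (suc ∣ p ∪ q ∣ ≤_) (sym (+-suc ∣ p ∣ ∣ q ∣)) (s≤s (∣p∪q∣≤∣p∣+∣q∣ p q))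
∣p∪q∣≤∣p∣+∣q∣ (inside  ∷ p) (outside ∷ q) = s≤s (∣p∪q∣≤∣p∣+∣q∣ p q)
∣p∪q∣≤∣p∣+∣q∣ (inside  ∷ p) (inside  ∷ q) =
  s≤s (≤-trans (∣p∪q∣≤∣p∣+∣q∣ p q) (+-monoʳ-≤ ∣ p ∣ (∣p∣≤∣x∷p∣ inside q)))

Disjoint-minus : ∀ {n} {A X : Subset n} {x} → x ∉ A → Disjoint A (X - x) → Disjoint A X
Disjoint-minus {x = x} x∉A A#X-x {y} y∈A y∈X with y ≟ᶠ x
... | yes refl = x∉A y∈A
... | no  y≢x  = A#X-x y∈A (x∈p∧x≢y⇒x∈p-y y∈X y≢x)

∣H∩[T∪Q]∣<∣T∣ : ∀ {n} {H T Q : Subset n} {a} → a ∈ T → a ∉ H → Disjoint Q H → ∣ H ∩ (T ∪ Q) ∣ < ∣ T ∣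
∣H∩[T∪Q]∣<∣T∣ {H = H} {T} {Q} {a} a∈T a∉H Q#H =
  ≤-<-trans (p⊆q⇒∣p∣≤∣q∣ H∩[T∪Q]⊆T-a) (x∈p⇒∣p-x∣<∣p∣ a∈T)
  where
  H∩[T∪Q]⊆T-a : H ∩ (T ∪ Q) ⊆ T - a
  H∩[T∪Q]⊆T-a {y} y∈ with x∈p∩q⁻ H (T ∪ Q) y∈
  ... | y∈H , y∈T∪Q with x∈p∪q⁻ T Q y∈T∪Q
  ...   | inj₁ y∈T = x∈p∧x≢y⇒x∈p-y y∈T λ { refl → a∉H y∈H }
  ...   | inj₂ y∈Q = ⊥-elim (Q#H y∈Q y∈H)

∣[T∪P]∩[T∪Q]∣≤∣T∣ : ∀ {n} {T P Q : Subset n} → Disjoint P Q → ∣ (T ∪ P) ∩ (T ∪ Q) ∣ ≤ ∣ T ∣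
∣[T∪P]∩[T∪Q]∣≤∣T∣ {T = T} {P} {Q} P#Q = p⊆q⇒∣p∣≤∣q∣ [T∪P]∩[T∪Q]⊆T
  where
  [T∪P]∩[T∪Q]⊆T : (T ∪ P) ∩ (T ∪ Q) ⊆ T
  [T∪P]∩[T∪Q]⊆T {y} y∈ with x∈p∩q⁻ (T ∪ P) (T ∪ Q) y∈
  ... | y∈T∪P , y∈T∪Q with x∈p∪q⁻ T P y∈T∪P | x∈p∪q⁻ T Q y∈T∪Q
  ...   | inj₁ y∈T | _        = y∈T
  ...   | inj₂ _   | inj₁ y∈T = y∈T
  ...   | inj₂ y∈P | inj₂ y∈Q = ⊥-elim (P#Q y∈P y∈Q)

∪-injective : ∀ {n u} (T : Subset n) {P : Fin u → Subset n} → PairwiseDisjoint P →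
  (∀ i → ∣ T ∣ < ∣ T ∪ P i ∣) → Injective _≡_ _≡_ (λ i → T ∪ P i)
∪-injective T {P} P# T<T∪P {i} {j} T∪Pi≡T∪Pj with i ≟ᶠ j
... | yes i≡j = i≡j
... | no  i≢j = ⊥-elim (<⇒≱ (T<T∪P i) (p⊆q⇒∣p∣≤∣q∣ T∪Pi⊆T))
  where
  T∪Pi⊆T : T ∪ P i ⊆ T
  T∪Pi⊆T {y} y∈ with x∈p∪q⁻ T (P i) y∈
  ... | inj₁ y∈T  = y∈T
  ... | inj₂ y∈Pi with x∈p∪q⁻ T (P j) (subst (y ∈_) T∪Pi≡T∪Pj y∈)
  ...   | inj₁ y∈T  = y∈T
  ...   | inj₂ y∈Pj = ⊥-elim (P# i j i≢j y∈Pi y∈Pj)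

◂-injective : ∀ {a} {A : Set a} {m} {x : A} {xs : Vector A m} →
  (∀ i → xs i ≢ x) → Injective _≡_ _≡_ xs → Injective _≡_ _≡_ (x ◂ xs)
◂-injective xs≢x xs-inj {zero}  {zero}  _  = refl
◂-injective xs≢x xs-inj {zero}  {suc j} eq = ⊥-elim (xs≢x j (sym eq))
◂-injective xs≢x xs-inj {suc i} {zero}  eq = ⊥-elim (xs≢x i eq)
◂-injective xs≢x xs-inj {suc i} {suc j} eq = cong suc (xs-inj eq)

-- Each petal meeting X is charged to one of its points (removed from X in the recursion);
-- the petals meeting no point of X are collected as the image of σ.
avoiding-indices : ∀ {n u} m (P : Fin u → Subset n) → PairwiseDisjoint P → (X : Subset n) →
  ∣ X ∣ + m ≤ u →
  Σ (Fin m → Fin u) λ σ → Injective _≡_ _≡_ σ × (∀ i → Disjoint (P (σ i)) X)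
avoiding-indices zero P P# X _ = (λ ()) , (λ { {()} }) , λ ()
avoiding-indices {u = zero} (suc m) P P# X X+m≤0 with m+n≤o⇒n≤o ∣ X ∣ X+m≤0
... | ()
avoiding-indices {u = suc u} (suc m) P P# X X+m≤u with nonempty? (P zero ∩ X)
... | no P₀∩X-empty = zero ◂ (suc ∘ σ) , ◂-injective (λ _ ()) (σ-inj ∘ suc-injective) , P₀◂Pσ#X
  where
  rec = avoiding-indices m (P ∘ suc) (λ i j i≢j → P# (suc i) (suc j) (i≢j ∘ suc-injective)) X
          (≤-pred (subst (_≤ suc u) (+-suc ∣ X ∣ m) X+m≤u))
  σ = proj₁ rec
  σ-inj = proj₁ (proj₂ rec)
  P₀◂Pσ#X : ∀ i → Disjoint (P ((zero ◂ (suc ∘ σ)) i)) X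
  P₀◂Pσ#X zero    y∈P₀ y∈X = P₀∩X-empty (_ , x∈p∩q⁺ (y∈P₀ , y∈X))
  P₀◂Pσ#X (suc i) = proj₂ (proj₂ rec) i
... | yes (x , x∈P₀∩X) = suc ∘ σ , suc∘σ-inj , Pσ#X
  where
  x∈P₀ = proj₁ (x∈p∩q⁻ (P zero) X x∈P₀∩X)
  x∈X = proj₂ (x∈p∩q⁻ (P zero) X x∈P₀∩X)
  X-x+m≤u : ∣ X - x ∣ + suc m ≤ u
  X-x+m≤u = ≤-pred (≤-trans (+-monoˡ-≤ (suc m) (x∈p⇒∣p-x∣<∣p∣ x∈X)) X+m≤u)
  rec = avoiding-indices (suc m) (P ∘ suc) (λ i j i≢j → P# (suc i) (suc j) (i≢j ∘ suc-injective))
          (X - x) X-x+m≤u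
  σ = proj₁ rec
  suc∘σ-inj : Injective _≡_ _≡_ (suc ∘ σ)
  suc∘σ-inj = proj₁ (proj₂ rec) ∘ suc-injective
  Pσ#X : ∀ i → Disjoint (P (suc (σ i))) X
  Pσ#X i = Disjoint-minus (P# zero (suc (σ i)) (λ ()) x∈P₀) (proj₂ (proj₂ rec) i)

sum-map-tabulate-≤ : ∀ {a} {A : Set a} m (g : Fin m → A) (f : A → ℕ) {c} →
  (∀ i → f (g i) ≤ c) → sum (map f (tabulate g)) ≤ m * c
sum-map-tabulate-≤ zero    g f fg≤c = z≤n
sum-map-tabulate-≤ (suc m) g f fg≤c = +-mono-≤ (fg≤c zero) (sum-map-tabulate-≤ m (g ∘ suc) f (fg≤c ∘ suc))

[1+n]C2≡n+nC2 : ∀ n → suc n C 2 ≡ n + n C 2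
[1+n]C2≡n+nC2 n = trans (sym (nCk+nC[k+1]≡[n+1]C[k+1] n 1)) (cong (_+ n C 2) (nC1≡n n))

pairSum-≤ : ∀ {n} m (S : Fin m → Subset n) {c} → (∀ i j → i ≢ j → ∣ S i ∩ S j ∣ ≤ c) →
  pairSum m S ≤ (m C 2) * c
pairSum-≤ zero    S Sij≤c = z≤n
pairSum-≤ (suc m) S {c} Sij≤c = begin
  pairSum (suc m) S
    ≤⟨ +-mono-≤ (sum-map-tabulate-≤ m (λ i → i) _ (λ j → Sij≤c zero (suc j) (λ ())))
                (pairSum-≤ m (S ∘ suc) (λ i j i≢j → Sij≤c (suc i) (suc j) (i≢j ∘ suc-injective))) ⟩
  m * c + (m C 2) * c  ≡⟨ sym (*-distribʳ-+ c m (m C 2)) ⟩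
  (m + m C 2) * c      ≡⟨ cong (_* c) (sym ([1+n]C2≡n+nC2 m)) ⟩
  (suc m C 2) * c      ∎
  where open ≤-Reasoning

pairSum-◂◂-≤ : ∀ {n} m s (F G : Subset n) (S : Fin m → Subset n) →
  (∀ i → ∣ F ∩ S i ∣ ≤ s) → (∀ i → ∣ G ∩ S i ∣ ≤ s) → (∀ i j → i ≢ j → ∣ S i ∩ S j ∣ ≤ suc s) →
  pairSum (2 + m) (F ◂ G ◂ S) ≤ ∣ F ∩ G ∣ + (m * s + (m * s + (m C 2) * suc s))
pairSum-◂◂-≤ m s F G S FS≤s GS≤s SS≤1+s = begin
  pairSum (2 + m) (F ◂ G ◂ S)
    ≤⟨ +-mono-≤ (+-monoʳ-≤ ∣ F ∩ G ∣ (sum-map-tabulate-≤ m suc _ FS≤s))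
                (+-mono-≤ (sum-map-tabulate-≤ m (λ i → i) _ GS≤s) (pairSum-≤ m S SS≤1+s)) ⟩
  (∣ F ∩ G ∣ + m * s) + (m * s + (m C 2) * suc s)
    ≡⟨ +-assoc ∣ F ∩ G ∣ (m * s) _ ⟩
  ∣ F ∩ G ∣ + (m * s + (m * s + (m C 2) * suc s)) ∎
  where open ≤-Reasoning

pairCondition-bound≡ : ∀ m s →
  ((2 + m) C 2) * s + (1 + m) C 2 ≡ (m * s + (m * s + (m C 2) * suc s)) + (s + m)
pairCondition-bound≡ m s = begin
  ((2 + m) C 2) * s + (1 + m) C 2
    ≡⟨ cong₂ (λ A B → A * s + B) (trans ([1+n]C2≡n+nC2 (suc m)) (cong (suc m +_) ([1+n]C2≡n+nC2 m)))
                                 ([1+n]C2≡n+nC2 m) ⟩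
  (suc m + (m + m C 2)) * s + (m + m C 2)
    ≡⟨ semiring-identity m s (m C 2) ⟩
  (m * s + (m * s + (m C 2) * suc s)) + (s + m) ∎
  where
  open ≡-Reasoning
  semiring-identity : ∀ m s c → (suc m + (m + c)) * s + (m + c) ≡ (m * s + (m * s + c * suc s)) + (s + m)
  semiring-identity = solve-∀

pairCondition⇒∩-≥ : ∀ {n} m s (F G : Subset n) (S : Fin m → Subset n) →
  (∀ i → ∣ F ∩ S i ∣ ≤ s) → (∀ i → ∣ G ∩ S i ∣ ≤ s) → (∀ i j → i ≢ j → ∣ S i ∩ S j ∣ ≤ suc s) →
  ((2 + m) C 2) * s + (1 + m) C 2 ≤ pairSum (2 + m) (F ◂ G ◂ S) → s + m ≤ ∣ F ∩ G ∣
pairCondition⇒∩-≥ m s F G S FS≤s GS≤s SS≤1+s bound =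
  +-cancelˡ-≤ K _ _ (begin
    K + (s + m)                      ≡⟨ sym (pairCondition-bound≡ m s) ⟩
    ((2 + m) C 2) * s + (1 + m) C 2  ≤⟨ bound ⟩
    pairSum (2 + m) (F ◂ G ◂ S)      ≤⟨ pairSum-◂◂-≤ m s F G S FS≤s GS≤s SS≤1+s ⟩
    ∣ F ∩ G ∣ + K                    ≡⟨ +-comm ∣ F ∩ G ∣ K ⟩
    K + ∣ F ∩ G ∣                    ∎)
  where
  open ≤-Reasoning
  K = m * s + (m * s + (m C 2) * suc s)

lemma3 : (n t ℓ k : ℕ) → 1 ≤ t → 3 ≤ ℓ → t + ℓ ∸ 2 ≤ k →
    (𝓕 : Family n) → Uniform k 𝓕 → PairCondition t ℓ 𝓕 →
    (T : Subset n) → ∣ T ∣ ≡ t → HasSunflower 𝓕 T (2 * k + ℓ ∸ 2) →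
    (a : Fin n) → a ∈ T →
    Intersecting (t ∸ 1 + (ℓ ∸ 2)) (Link 𝓕 T a)
lemma3 n (suc s) (suc (suc m)) k (s≤s z≤n) (s≤s (s≤s 1≤m)) t+ℓ-2≤k 𝓕 uniform pairCondition
       T ∣T∣≡t (P , _ , P∩P≡∅ , T∪P∈𝓕) a a∈T F G (F∈𝓕 , _ , a∉F) (G∈𝓕 , _ , a∉G) F≢G =
  pairCondition⇒∩-≥ m s F G S (link-bound a∉F (x∈p∪q⁺ ∘ inj₁)) (link-bound a∉G (x∈p∪q⁺ ∘ inj₂))
    (λ i j i≢j → ≤-trans (∣[T∪P]∩[T∪Q]∣≤∣T∣ {T = T} (P# _ _ (i≢j ∘ σ-inj))) (≤-reflexive ∣T∣≡t))
    (pairCondition (F ◂ G ◂ S) (◂-injective F∉ (◂-injective G∉ S-inj)) members)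
  where
  P# : PairwiseDisjoint P
  P# i j i≢j = ∩≡∅⇒Disjoint (P∩P≡∅ i j i≢j)
  ∣F∪G∣+m≤u : ∣ F ∪ G ∣ + m ≤ 2 * k + suc (suc m) ∸ 2
  ∣F∪G∣+m≤u = subst (∣ F ∪ G ∣ + m ≤_) (sym (+-∸-assoc (2 * k) (s≤s (s≤s z≤n))))
    (+-monoˡ-≤ m (≤-trans (∣p∪q∣≤∣p∣+∣q∣ F G)
      (≤-reflexive (cong₂ _+_ (uniform F F∈𝓕) (trans (uniform G G∈𝓕) (sym (+-identityʳ k)))))))
  chosen = avoiding-indices m P P# (F ∪ G) ∣F∪G∣+m≤u
  σ = proj₁ chosen
  σ-inj = proj₁ (proj₂ chosen)
  σ-avoids = proj₂ (proj₂ chosen)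
  S : Fin m → Subset n
  S i = T ∪ P (σ i)
  t<k : suc s < k
  t<k = ≤-trans (m<m+n (suc s) 1≤m) (subst (_≤ k) (+-∸-assoc (suc s) (s≤s (s≤s z≤n))) t+ℓ-2≤k)
  S-inj : Injective _≡_ _≡_ S
  S-inj = σ-inj ∘ ∪-injective T P# (λ p → subst₂ _<_ (sym ∣T∣≡t) (sym (uniform _ (T∪P∈𝓕 p))) t<k)
  link-bound : ∀ {H} → a ∉ H → H ⊆ F ∪ G → ∀ i → ∣ H ∩ S i ∣ ≤ s
  link-bound {H} a∉H H⊆F∪G i = ≤-pred (subst (∣ H ∩ S i ∣ <_) ∣T∣≡t
    (∣H∩[T∪Q]∣<∣T∣ {Q = P (σ i)} a∈T a∉H (λ y∈P y∈H → σ-avoids i y∈P (H⊆F∪G y∈H))))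
  a∈S : ∀ i → a ∈ S i
  a∈S i = x∈p∪q⁺ (inj₁ a∈T)
  G∉ : ∀ i → S i ≢ G
  G∉ i S≡G = a∉G (subst (a ∈_) S≡G (a∈S i))
  F∉ : ∀ i → (G ◂ S) i ≢ F
  F∉ zero    = F≢G ∘ sym
  F∉ (suc i) S≡F = a∉F (subst (a ∈_) S≡F (a∈S i))
  members : ∀ i → 𝓕 ((F ◂ G ◂ S) i)
  members zero          = F∈𝓕
  members (suc zero)    = G∈𝓕
  members (suc (suc i)) = T∪P∈𝓕 (σ i)
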